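{- Let $n>1$, $p>1$ and $m\ge 1$ be integers. Then $\theta(mH_{n,p})=0$ if $n$ is even or $mnp$ is odd, and $\theta(mH_{n,p})=1$ otherwise.
   Context: $H_{n,p}$ denotes the complete multipartite graph with $p$ parts each having exactly $n$ vertices, and $mH_{n,p}$ denotes the disjoint union of $m$ copies of $H_{n,p}$. For a finite set $S$ of positive integers with $|S|=|V(G)|$, a graph $G$ is $S$-magic if there is a bijection $f:V(G)\to S$ and a constant $c$ with $\sum_{v\in N(u)} f(v)=c$ for every vertex $u$, where $N(u)$ is the set of neighbours of $u$. Let $\alpha(S)=\max S$ and $i(G)=\min \alpha(S)$ over all $S$ for which $G$ is $S$-magic; the distance magic index is $\theta(G)=i(G)-|V(G)|$ (and $\theta(G)=\infty$ if no such $S$ exists). -}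

module Defs where

open import Data.Nat using (ℕ; zero; suc; _+_; _*_; _≤_; _<_; _⊔_)
open import Data.Bool using (Bool; true; false; if_then_else_; _∧_; not)
open import Data.Fin as Fin using (Fin; remQuot)
open import Data.Fin.Properties using (_≟_)
open import Data.List using (List; map; foldr; allFin)
open import Data.Nat.ListAction using (sum)
open import Data.Product using (Σ; _×_; _,_; proj₁; proj₂; ∃)
open import Function.Definitions using (Injective)
open import Relation.Binary.PropositionalEquality using (_≡_; refl; sym; cong₂; cong)
open import Relation.Nullary using (yes; no)
open import Data.Empty using (⊥-elim)
open import Relation.Nullary.Decidable using (⌊_⌋)

record Graph : Set where
  field
    order : ℕ
    adj   : Fin order → Fin order → Bool
    adj-sym : ∀ u v → adj u v ≡ adj v u
    adj-irr : ∀ v → adj v v ≡ false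
open Graph public

nbrSum : (G : Graph) → (Fin (order G) → ℕ) → Fin (order G) → ℕ
nbrSum G f u = sum (map (λ v → if adj G u v then f v else 0) (allFin (order G)))

maxLabel : ∀ {N} → (Fin N → ℕ) → ℕ
maxLabel {N} f = foldr _⊔_ 0 (map f (allFin N))

-- f is a bijection V(G) → S (S := image f, a set of positive integers with
-- |S| = |V(G)|) making G S-magic with magic constant c.
IsMagicLabelling : (G : Graph) → (Fin (order G) → ℕ) → Set
IsMagicLabelling G f =
  Injective _≡_ _≡_ f × (∀ v → 0 < f v) ×
  Σ ℕ (λ c → ∀ u → nbrSum G f u ≡ c)

MagicIndexIs : Graph → ℕ → Set
MagicIndexIs G k =
  (Σ (Fin (order G) → ℕ) λ f → IsMagicLabelling G f × maxLabel f ≡ k) ×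
  (∀ f → IsMagicLabelling G f → k ≤ maxLabel f)

-- θ(G) = t  (finite value), i.e. i(G) = |V(G)| + t
DistMagicIndexIs : Graph → ℕ → Set
DistMagicIndexIs G t = MagicIndexIs G (order G + t)

-- m H_{n,p}: vertex set Fin (m * (p * n)); vertex ↦ (copy, part, position).
copyOf : ∀ m p n → Fin (m * (p * n)) → Fin m
copyOf m p n v = proj₁ (remQuot {m} (p * n) v)

partOf : ∀ m p n → Fin (m * (p * n)) → Fin p
partOf m p n v = proj₁ (remQuot {p} n (proj₂ (remQuot {m} (p * n) v)))

mHadj : ∀ m p n → Fin (m * (p * n)) → Fin (m * (p * n)) → Bool
mHadj m p n u v =
  ⌊ copyOf m p n u ≟ copyOf m p n v ⌋ ∧ not ⌊ partOf m p n u ≟ partOf m p n v ⌋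

private
  ≟-sym : ∀ {k} (a b : Fin k) → ⌊ a ≟ b ⌋ ≡ ⌊ b ≟ a ⌋
  ≟-sym a b with a ≟ b | b ≟ a
  ... | yes _ | yes _ = refl
  ... | no _  | no _  = refl
  ... | yes e | no ne = ⊥-elim (ne (sym e))
  ... | no ne | yes e = ⊥-elim (ne (sym e))

  ≟-refl : ∀ {k} (a : Fin k) → ⌊ a ≟ a ⌋ ≡ true
  ≟-refl a with a ≟ a
  ... | yes _ = refl
  ... | no ne = ⊥-elim (ne refl)

  ∧-false : ∀ b → b ∧ false ≡ false
  ∧-false true = refl
  ∧-false false = refl

mH : (m n p : ℕ) → Graph
mH m n p = record
  { order = m * (p * n)
  ; adj   = mHadj m p n
  ; adj-sym = λ u v → cong₂ _∧_ (≟-sym (copyOf m p n u) (copyOf m p n v))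
                              (cong not (≟-sym (partOf m p n u) (partOf m p n v)))
  ; adj-irr = λ v → helper v
  }
  where
  helper : ∀ v → mHadj m p n v v ≡ false
  helper v rewrite ≟-refl (partOf m p n v) = ∧-false _

module Submission where

-- An injective positive labelling of N vertices has a label ≥ N, so θ ≥ 0.  In a
-- distance magic labelling the neighbourhood sum of u is the sum over u's copy minus the sum over
-- u's part, so all parts carry the same sum β.  If n is odd and mnp even, labels 1, …, N (N = mnp)
-- would give 2·mpβ = N(N + 1), i.e. the even number 2β would equal the odd number n(N + 1); so θ ≥ 1.
--
-- Conversely, any labelling giving every part the same sum is distance magic, so it
-- suffices to fill an array with mp columns (the parts) and n rows with distinct positive entries
-- and constant column sums.  Stacking pairs of rows b + 1, 2mp − b handles even n with entries
-- 1, …, N.  For odd n one more three-row block is needed, which uses the entries 1, …, 3mp when mp is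
-- odd and 3mp values from 1, …, 3mp + 1 when mp is even.

open import Defs
open import Data.Bool using (Bool; true; false; if_then_else_; _∧_; not)
open import Data.Empty using (⊥; ⊥-elim)
open import Data.Fin using (Fin; zero; suc; toℕ; fromℕ<; punchIn; combine; remQuot; splitAt; _↑ˡ_; _↑ʳ_)
open import Data.Fin.Properties
  using (remQuot-combine; combine-remQuot; combine-injective; toℕ-injective; toℕ<n; toℕ-fromℕ<;
         punchIn-injective; any?; pigeonhole; splitAt-↑ˡ; splitAt-↑ʳ; splitAt⁻¹-↑ˡ; splitAt⁻¹-↑ʳ; _≟_)
open import Data.List using (allFin; tabulate; map; foldr)
open import Data.List.Properties using (map-tabulate)
import Data.Nat.ListAction as List
open import Data.Nat
  using (ℕ; zero; suc; pred; >-nonZero; z<s; s≤s⁻¹; _+_; _*_; _∸_; _⊔_; _%_; _/_; _<_; _≤_; z≤n; s≤s; _≤?_; _<?_)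
open import Data.Nat.DivMod using (m≡m%n+[m/n]*n; m%n<n; %-distribˡ-*; m%n%n≡m%n)
open import Data.Nat.Properties hiding (_≟_)
open import Data.Product using (∃; _×_; _,_; proj₁; proj₂)
open import Data.Sum using (_⊎_; inj₁; inj₂; [_,_]′)
open import Function using (_∘_)
open import Function.Definitions using (Injective)
open import Relation.Binary.PropositionalEquality
open import Relation.Nullary using (yes; no; ¬_)
open import Relation.Nullary.Decidable using (⌊_⌋)
open import Algebra.Properties.CommutativeMonoid.Sum +-0-commutativeMonoid
  using (sum; sum-syntax; sum-cong-≗; ∑-distrib-+; sum-remove)
open import Data.Nat.Tactic.RingSolver using (solve-∀)


sum-const : ∀ n x → ∑[ _ < n ] x ≡ n * x
sum-const zero    x = refl
sum-const (suc n) x = cong (x +_) (sum-const n x)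

sum-zero : ∀ n → ∑[ _ < n ] 0 ≡ 0
sum-zero n = trans (sum-const n 0) (*-zeroʳ n)

sum-tabulate : ∀ {k} (h : Fin k → ℕ) → List.sum (tabulate h) ≡ sum h
sum-tabulate {zero}  h = refl
sum-tabulate {suc k} h = cong (h zero +_) (sum-tabulate (h ∘ suc))

sum-allFin : ∀ {k} (h : Fin k → ℕ) → List.sum (map h (allFin k)) ≡ sum h
sum-allFin h = trans (cong List.sum (map-tabulate (λ i → i) h)) (sum-tabulate h)

sum-↑ : ∀ a c (h : Fin (a + c) → ℕ) →
        sum h ≡ ∑[ i < a ] h (i ↑ˡ c) + ∑[ j < c ] h (a ↑ʳ j)
sum-↑ zero    c h = refl
sum-↑ (suc a) c h =
  trans (cong (h zero +_) (sum-↑ a c (h ∘ suc))) (sym (+-assoc (h zero) _ _))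

sum-combine : ∀ a b (h : Fin (a * b) → ℕ) →
              sum h ≡ ∑[ i < a ] ∑[ j < b ] h (combine i j)
sum-combine zero    b h = refl
sum-combine (suc a) b h =
  trans (sum-↑ b (a * b) h) (cong (∑[ j < b ] h (combine {suc a} zero j) +_) (sum-combine a b (h ∘ (b ↑ʳ_))))

sum-if : ∀ {k} (c : Bool) (h : Fin k → ℕ) →
         ∑[ i < k ] (if c then h i else 0) ≡ (if c then sum h else 0)
sum-if         true  h = refl
sum-if {k = k} false h = sum-zero k

≟-suc : ∀ {k} (a i : Fin k) → ⌊ suc a ≟ suc i ⌋ ≡ ⌊ a ≟ i ⌋
≟-suc a i with a ≟ i
... | yes _ = refl
... | no  _ = refl

sum-δ : ∀ {k} (a : Fin k) (h : Fin k → ℕ) → ∑[ i < k ] (if ⌊ a ≟ i ⌋ then h i else 0) ≡ h a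
sum-δ {suc k} zero    h = trans (cong (h zero +_) (sum-zero k)) (+-identityʳ (h zero))
sum-δ {suc k} (suc a) h =
  trans (sum-cong-≗ (λ i → cong (λ c → if c then h (suc i) else 0) (≟-suc a i))) (sum-δ a (h ∘ suc))

if-not+if : ∀ c x → (if not c then x else 0) + (if c then x else 0) ≡ x
if-not+if true  x = refl
if-not+if false x = +-identityʳ x

sum-δᶜ : ∀ {k} (a : Fin k) (h : Fin k → ℕ) →
         ∑[ i < k ] (if not ⌊ a ≟ i ⌋ then h i else 0) + h a ≡ sum h
sum-δᶜ {k} a h = begin
  ∑[ i < k ] (if not ⌊ a ≟ i ⌋ then h i else 0) + h a
    ≡⟨ cong (∑[ i < k ] (if not ⌊ a ≟ i ⌋ then h i else 0) +_) (sym (sum-δ a h)) ⟩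
  ∑[ i < k ] (if not ⌊ a ≟ i ⌋ then h i else 0) + ∑[ i < k ] (if ⌊ a ≟ i ⌋ then h i else 0)
    ≡⟨ sym (∑-distrib-+ (λ i → if not ⌊ a ≟ i ⌋ then h i else 0) (λ i → if ⌊ a ≟ i ⌋ then h i else 0)) ⟩
  ∑[ i < k ] ((if not ⌊ a ≟ i ⌋ then h i else 0) + (if ⌊ a ≟ i ⌋ then h i else 0))
    ≡⟨ sum-cong-≗ (λ i → if-not+if ⌊ a ≟ i ⌋ (h i)) ⟩
  sum h ∎
  where open ≡-Reasoning

-- The vertices of m H_{n,p}

module _ (m n p : ℕ) where

  vertex : Fin m → Fin p → Fin n → Fin (m * (p * n))
  vertex i j r = combine i (combine j r)

  positionOf : Fin (m * (p * n)) → Fin n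
  positionOf v = proj₂ (remQuot {p} n (proj₂ (remQuot {m} (p * n) v)))

  copyOf-vertex : ∀ i j r → copyOf m p n (vertex i j r) ≡ i
  copyOf-vertex i j r = cong proj₁ (remQuot-combine i (combine j r))

  partOf-vertex : ∀ i j r → partOf m p n (vertex i j r) ≡ j
  partOf-vertex i j r =
    trans (cong (λ w → proj₁ (remQuot {p} n (proj₂ w))) (remQuot-combine i (combine j r)))
          (cong proj₁ (remQuot-combine j r))

  positionOf-vertex : ∀ i j r → positionOf (vertex i j r) ≡ r
  positionOf-vertex i j r =
    trans (cong (λ w → proj₂ (remQuot {p} n (proj₂ w))) (remQuot-combine i (combine j r)))
          (cong proj₂ (remQuot-combine j r))

  vertex-decomposition : ∀ v → vertex (copyOf m p n v) (partOf m p n v) (positionOf v) ≡ v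
  vertex-decomposition v =
    trans (cong (combine (copyOf m p n v)) (combine-remQuot {p} n (proj₂ (remQuot {m} (p * n) v))))
          (combine-remQuot {m} (p * n) v)

  sum-vertices : (h : Fin (m * (p * n)) → ℕ) →
                 sum h ≡ ∑[ i < m ] ∑[ j < p ] ∑[ r < n ] h (vertex i j r)
  sum-vertices h = trans (sum-combine m (p * n) h)
                         (sum-cong-≗ {m} (λ i → sum-combine p n (h ∘ combine i)))

  partSum : (Fin (m * (p * n)) → ℕ) → Fin m → Fin p → ℕ
  partSum f i j = ∑[ r < n ] f (vertex i j r)

  nbrSum+partSum : ∀ f u →
    nbrSum (mH m n p) f u + partSum f (copyOf m p n u) (partOf m p n u)
      ≡ ∑[ j < p ] partSum f (copyOf m p n u) j
  nbrSum+partSum f u = trans (cong (_+ partSum f cu pu) expand) (sum-δᶜ pu (partSum f cu))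
    where
    cu = copyOf m p n u
    pu = partOf m p n u
    adjacentTo : Fin m → Fin p → Bool
    adjacentTo i j = ⌊ cu ≟ i ⌋ ∧ not ⌊ pu ≟ j ⌋
    ifAdjacent : Fin m → Fin p → ℕ → ℕ
    ifAdjacent i j x = if adjacentTo i j then x else 0
    if-∧ : ∀ a b (x : ℕ) → (if a ∧ b then x else 0) ≡ (if a then (if b then x else 0) else 0)
    if-∧ true  b x = refl
    if-∧ false b x = refl
    expand : nbrSum (mH m n p) f u ≡ ∑[ j < p ] (if not ⌊ pu ≟ j ⌋ then partSum f cu j else 0)
    expand = begin
      nbrSum (mH m n p) f u
        ≡⟨ sum-allFin (λ v → if mHadj m p n u v then f v else 0) ⟩
      ∑[ v < m * (p * n) ] (if mHadj m p n u v then f v else 0)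
        ≡⟨ sum-vertices (λ v → if mHadj m p n u v then f v else 0) ⟩
      ∑[ i < m ] ∑[ j < p ] ∑[ r < n ] (if mHadj m p n u (vertex i j r) then f (vertex i j r) else 0)
        ≡⟨ sum-cong-≗ {m} (λ i → sum-cong-≗ {p} (λ j → sum-cong-≗ {n} (λ r →
             cong₂ (λ a b → if ⌊ cu ≟ a ⌋ ∧ not ⌊ pu ≟ b ⌋ then f (vertex i j r) else 0)
                   (copyOf-vertex i j r) (partOf-vertex i j r)))) ⟩
      ∑[ i < m ] ∑[ j < p ] ∑[ r < n ] ifAdjacent i j (f (vertex i j r))
        ≡⟨ sum-cong-≗ {m} (λ i → sum-cong-≗ {p} (λ j → sum-if (adjacentTo i j) (f ∘ vertex i j))) ⟩
      ∑[ i < m ] ∑[ j < p ] ifAdjacent i j (partSum f i j)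
        ≡⟨ sum-cong-≗ {m} (λ i → trans (sum-cong-≗ {p} (λ j → if-∧ ⌊ cu ≟ i ⌋ _ (partSum f i j)))
                                   (sum-if ⌊ cu ≟ i ⌋ (λ j → if not ⌊ pu ≟ j ⌋ then partSum f i j else 0))) ⟩
      ∑[ i < m ] (if ⌊ cu ≟ i ⌋ then ∑[ j < p ] (if not ⌊ pu ≟ j ⌋ then partSum f i j else 0) else 0)
        ≡⟨ sum-δ cu (λ i → ∑[ j < p ] (if not ⌊ pu ≟ j ⌋ then partSum f i j else 0)) ⟩
      ∑[ j < p ] (if not ⌊ pu ≟ j ⌋ then partSum f cu j else 0) ∎
      where open ≡-Reasoning

Positive : ∀ {N} → (Fin N → ℕ) → Set
Positive f = ∀ v → 0 < f v

maxLabel≡foldr-tabulate : ∀ {N} (f : Fin N → ℕ) → maxLabel f ≡ foldr _⊔_ 0 (tabulate f)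
maxLabel≡foldr-tabulate f = cong (foldr _⊔_ 0) (map-tabulate (λ v → v) f)

≤-foldr-⊔-tabulate : ∀ {k} (h : Fin k → ℕ) i → h i ≤ foldr _⊔_ 0 (tabulate h)
≤-foldr-⊔-tabulate h zero    = m≤m⊔n _ _
≤-foldr-⊔-tabulate h (suc i) = ≤-trans (≤-foldr-⊔-tabulate (h ∘ suc) i) (m≤n⊔m _ _)

foldr-⊔-tabulate-≤ : ∀ {k} (h : Fin k → ℕ) {M} → (∀ i → h i ≤ M) → foldr _⊔_ 0 (tabulate h) ≤ M
foldr-⊔-tabulate-≤ {zero}  h bound = z≤n
foldr-⊔-tabulate-≤ {suc k} h bound = ⊔-lub (bound zero) (foldr-⊔-tabulate-≤ (h ∘ suc) (bound ∘ suc))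

label≤maxLabel : ∀ {N} (f : Fin N → ℕ) v → f v ≤ maxLabel f
label≤maxLabel f v = subst (f v ≤_) (sym (maxLabel≡foldr-tabulate f)) (≤-foldr-⊔-tabulate f v)

maxLabel≤ : ∀ {N} (f : Fin N → ℕ) {M} → (∀ v → f v ≤ M) → maxLabel f ≤ M
maxLabel≤ f bound = subst (_≤ _) (sym (maxLabel≡foldr-tabulate f)) (foldr-⊔-tabulate-≤ f bound)

-- Pigeonhole: otherwise pred ∘ f would inject Fin (suc N) into Fin N.
∃label≥size : ∀ {N} (f : Fin (suc N) → ℕ) → Injective _≡_ _≡_ f → Positive f →
              ∃ λ v → suc N ≤ f v
∃label≥size {N} f f-inj f-pos with any? (λ v → suc N ≤? f v)
... | yes large = large
... | no ¬large =
  let i , j , i<j , lower-i≡j = pigeonhole (n<1+n N) lower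
  in ⊥-elim (<-irrefl (cong toℕ (f-inj (pred∘f-injective lower-i≡j))) i<j)
  where
  pred∘f<N : ∀ v → pred (f v) < N
  pred∘f<N v = pred-mono-< {{>-nonZero (f-pos v)}} (≰⇒> (λ large → ¬large (v , large)))
  lower : Fin (suc N) → Fin N
  lower v = fromℕ< (pred∘f<N v)
  pred∘f-injective : ∀ {v w} → lower v ≡ lower w → f v ≡ f w
  pred∘f-injective {v} {w} e = pred-injective {{>-nonZero (f-pos v)}} {{>-nonZero (f-pos w)}}
    (trans (sym (toℕ-fromℕ< (pred∘f<N v))) (trans (cong toℕ e) (toℕ-fromℕ< (pred∘f<N w))))

size≤maxLabel : ∀ {N} (f : Fin N → ℕ) → Injective _≡_ _≡_ f → Positive f → N ≤ maxLabel f
size≤maxLabel {zero}  f f-inj f-pos = z≤n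
size≤maxLabel {suc N} f f-inj f-pos =
  ≤-trans (proj₂ (∃label≥size f f-inj f-pos)) (label≤maxLabel f (proj₁ (∃label≥size f f-inj f-pos)))

triangular≤2*sum : ∀ N (f : Fin N → ℕ) → Injective _≡_ _≡_ f → Positive f → N * suc N ≤ 2 * sum f
triangular≤2*sum zero    f f-inj f-pos = z≤n
triangular≤2*sum (suc N) f f-inj f-pos = begin
  suc N * suc (suc N)        ≡⟨ regroup N ⟩
  N * suc N + 2 * suc N      ≤⟨ +-mono-≤ (triangular≤2*sum N f′ f′-inj (f-pos ∘ punchIn v)) (*-monoʳ-≤ 2 large) ⟩
  2 * sum f′ + 2 * f v       ≡⟨ trans (sym (*-distribˡ-+ 2 (sum f′) (f v))) (cong (2 *_) (+-comm (sum f′) (f v))) ⟩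
  2 * (f v + sum f′)         ≡⟨ cong (2 *_) (sym (sum-remove f)) ⟩
  2 * sum f                  ∎
  where
  open ≤-Reasoning
  regroup : ∀ N → suc N * suc (suc N) ≡ N * suc N + 2 * suc N
  regroup = solve-∀
  v = proj₁ (∃label≥size f f-inj f-pos)
  large = proj₂ (∃label≥size f f-inj f-pos)
  f′ = f ∘ punchIn v
  f′-inj : Injective _≡_ _≡_ f′
  f′-inj = punchIn-injective v _ _ ∘ f-inj

-- Apply the lower bound to the reflected labelling v ↦ N + 1 − f v.
2*sum≤triangular : ∀ N (f : Fin N → ℕ) → Injective _≡_ _≡_ f → Positive f → (∀ v → f v ≤ N) →
                   2 * sum f ≤ N * suc N
2*sum≤triangular N f f-inj f-pos f≤N = +-cancelˡ-≤ (2 * sum g) _ _ (begin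
  2 * sum g + 2 * sum f          ≡⟨ sym (*-distribˡ-+ 2 (sum g) (sum f)) ⟩
  2 * (sum g + sum f)            ≡⟨ cong (2 *_) (sym (∑-distrib-+ g f)) ⟩
  2 * ∑[ v < N ] (g v + f v)     ≡⟨ cong (2 *_) (sum-cong-≗ {N} (λ v → m∸n+n≡m (m≤n⇒m≤1+n (f≤N v)))) ⟩
  2 * ∑[ _ < N ] suc N           ≡⟨ cong (2 *_) (sum-const N (suc N)) ⟩
  2 * (N * suc N)                ≡⟨ cong (N * suc N +_) (+-identityʳ (N * suc N)) ⟩
  N * suc N + N * suc N          ≤⟨ +-monoˡ-≤ (N * suc N) (triangular≤2*sum N g g-inj g-pos) ⟩
  2 * sum g + N * suc N          ∎)
  where
  open ≤-Reasoning
  g : Fin N → ℕ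
  g v = suc N ∸ f v
  g-inj : Injective _≡_ _≡_ g
  g-inj e = f-inj (∸-cancelˡ-≡ (m≤n⇒m≤1+n (f≤N _)) (m≤n⇒m≤1+n (f≤N _)) e)
  g-pos : Positive g
  g-pos v = m<n⇒0<n∸m (s≤s (f≤N v))

2*sum≡triangular : ∀ N (f : Fin N → ℕ) → Injective _≡_ _≡_ f → Positive f → (∀ v → f v ≤ N) →
                   2 * sum f ≡ N * suc N
2*sum≡triangular N f f-inj f-pos f≤N =
  ≤-antisym (2*sum≤triangular N f f-inj f-pos f≤N) (triangular≤2*sum N f f-inj f-pos)

-- Distance magic labellings of m H_{n,p}

sum-equalPartSums : ∀ m n p (f : Fin (m * (p * n)) → ℕ) β →
  (∀ i j → partSum m n p f i j ≡ β) → sum f ≡ m * (p * β)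
sum-equalPartSums m n p f β partSum≡β = begin
  sum f                                  ≡⟨ sum-vertices m n p f ⟩
  ∑[ i < m ] ∑[ j < p ] partSum m n p f i j ≡⟨ sum-cong-≗ {m} (λ i → sum-cong-≗ {p} (partSum≡β i)) ⟩
  ∑[ i < m ] ∑[ j < p ] β                ≡⟨ sum-cong-≗ {m} (λ i → sum-const p β) ⟩
  ∑[ i < m ] (p * β)                     ≡⟨ sum-const m (p * β) ⟩
  m * (p * β)                            ∎
  where open ≡-Reasoning

-- The neighbourhood sum of u is (copy sum) − (part sum), so all parts of copy i carry the same sum βᵢ;
-- then c = (p − 1) βᵢ forces βᵢ to be the same for all copies.
magic⇒partSums-equal : ∀ m n p (f : Fin (suc m * (suc (suc p) * suc n)) → ℕ) c →
  (∀ u → nbrSum (mH (suc m) (suc n) (suc (suc p))) f u ≡ c) →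
  ∃ λ β → ∀ i j → partSum (suc m) (suc n) (suc (suc p)) f i j ≡ β
magic⇒partSums-equal m n p f c magic = β zero , λ i j → trans (β-row i j) (β-copy i)
  where
  M = suc m
  N = suc n
  P = suc (suc p)
  copySum : Fin M → ℕ
  copySum i = ∑[ j < P ] partSum M N P f i j
  c+partSum : ∀ i j → c + partSum M N P f i j ≡ copySum i
  c+partSum i j = begin
    c + partSum M N P f i j
      ≡⟨ cong₂ (λ x i′ → x + partSum M N P f i′ j) (sym (magic u)) (sym (copyOf-vertex M N P i j zero)) ⟩
    nbrSum (mH M N P) f u + partSum M N P f (copyOf M P N u) j
      ≡⟨ cong (λ j′ → nbrSum (mH M N P) f u + partSum M N P f (copyOf M P N u) j′) (sym (partOf-vertex M N P i j zero)) ⟩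
    nbrSum (mH M N P) f u + partSum M N P f (copyOf M P N u) (partOf M P N u)
      ≡⟨ nbrSum+partSum M N P f u ⟩
    ∑[ j′ < P ] partSum M N P f (copyOf M P N u) j′
      ≡⟨ cong (λ i′ → ∑[ j′ < P ] partSum M N P f i′ j′) (copyOf-vertex M N P i j zero) ⟩
    copySum i ∎
    where
    open ≡-Reasoning
    u = vertex M N P i j zero
  β : Fin M → ℕ
  β i = partSum M N P f i zero
  β-row : ∀ i j → partSum M N P f i j ≡ β i
  β-row i j = +-cancelˡ-≡ c _ _ (trans (c+partSum i j) (sym (c+partSum i zero)))
  c≡ : ∀ i → c ≡ suc p * β i
  c≡ i = +-cancelʳ-≡ (β i) c (suc p * β i) (begin
    c + β i                        ≡⟨ c+partSum i zero ⟩
    copySum i                      ≡⟨ sum-cong-≗ {P} (β-row i) ⟩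
    ∑[ _ < P ] β i                 ≡⟨ sum-const P (β i) ⟩
    P * β i                        ≡⟨ +-comm (β i) (suc p * β i) ⟩
    suc p * β i + β i              ∎)
    where open ≡-Reasoning
  β-copy : ∀ i → β i ≡ β zero
  β-copy i = *-cancelˡ-≡ (β i) (β zero) (suc p) (trans (sym (c≡ i)) (c≡ zero))

-- Label arrays

record Row (q t : ℕ) : Set where
  field
    value           : Fin q → ℕ
    value<top       : ∀ b → value b < t
    value-injective : Injective _≡_ _≡_ value
open Row

record LabelArray (q n : ℕ) : Set where
  field
    top             : ℕ
    entry           : Fin q → Fin n → ℕ
    entry-positive  : ∀ b r → 0 < entry b r
    entry≤top       : ∀ b r → entry b r ≤ top
    entry-injective : ∀ {b r b′ r′} → entry b r ≡ entry b′ r′ → b ≡ b′ × r ≡ r′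
open LabelArray

colSum : ∀ {q n} → LabelArray q n → Fin q → ℕ
colSum {n = n} A b = ∑[ r < n ] entry A b r

IsColumnMagic : ∀ {q n} → LabelArray q n → Set
IsColumnMagic A = ∃ λ s → ∀ b → colSum A b ≡ s

row : ∀ {q t} → Row q t → LabelArray q 1
row {t = t} R = record
  { top             = t
  ; entry           = λ b _ → suc (value R b)
  ; entry-positive  = λ _ _ → s≤s z≤n
  ; entry≤top       = λ b _ → value<top R b
  ; entry-injective = λ { {r = zero} {r′ = zero} e → value-injective R (suc-injective e) , refl }
  }

colSum-row : ∀ {q t} (R : Row q t) b → colSum (row R) b ≡ suc (value R b)
colSum-row R b = +-identityʳ (suc (value R b))

emptyArray : ∀ {q} → LabelArray q 0
emptyArray = record
  { top             = 0
  ; entry           = λ _ ()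
  ; entry-positive  = λ _ ()
  ; entry≤top       = λ _ ()
  ; entry-injective = λ { {r = ()} }
  }

infixr 5 _⊕_

_⊕_ : ∀ {q n₁ n₂} → LabelArray q n₁ → LabelArray q n₂ → LabelArray q (n₁ + n₂)
_⊕_ {q} {n₁} {n₂} A B = record
  { top             = top A + top B
  ; entry           = stacked
  ; entry-positive  = positive
  ; entry≤top       = bounded
  ; entry-injective = injective
  }
  where
  stacked : Fin q → Fin (n₁ + n₂) → ℕ
  stacked b r = [ entry A b , (λ j → top A + entry B b j) ]′ (splitAt n₁ r)
  A<shiftedB : ∀ b i b′ j → entry A b i < top A + entry B b′ j
  A<shiftedB b i b′ j = ≤-<-trans (entry≤top A b i) (m<m+n (top A) (entry-positive B b′ j))
  positive : ∀ b r → 0 < stacked b r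
  positive b r with splitAt n₁ r
  ... | inj₁ i = entry-positive A b i
  ... | inj₂ j = <-≤-trans (entry-positive B b j) (m≤n+m _ (top A))
  bounded : ∀ b r → stacked b r ≤ top A + top B
  bounded b r with splitAt n₁ r
  ... | inj₁ i = ≤-trans (entry≤top A b i) (m≤m+n (top A) (top B))
  ... | inj₂ j = +-monoʳ-≤ (top A) (entry≤top B b j)
  injective : ∀ {b r b′ r′} → stacked b r ≡ stacked b′ r′ → b ≡ b′ × r ≡ r′
  injective {b} {r} {b′} {r′} e with splitAt n₁ r in r≡ | splitAt n₁ r′ in r′≡
  ... | inj₁ i | inj₁ i′ with refl , refl ← entry-injective A e =
    refl , trans (sym (splitAt⁻¹-↑ˡ r≡)) (splitAt⁻¹-↑ˡ r′≡)
  ... | inj₂ j | inj₂ j′ with refl , refl ← entry-injective B (+-cancelˡ-≡ (top A) _ _ e) =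
    refl , trans (sym (splitAt⁻¹-↑ʳ r≡)) (splitAt⁻¹-↑ʳ r′≡)
  ... | inj₁ i | inj₂ j′ = ⊥-elim (<-irrefl e (A<shiftedB b i b′ j′))
  ... | inj₂ j | inj₁ i′ = ⊥-elim (<-irrefl (sym e) (A<shiftedB b′ i′ b j))

colSum-⊕ : ∀ {q n₁ n₂} (A : LabelArray q n₁) (B : LabelArray q n₂) b →
           colSum (A ⊕ B) b ≡ colSum A b + (n₂ * top A + colSum B b)
colSum-⊕ {q} {n₁} {n₂} A B b = begin
  colSum (A ⊕ B) b
    ≡⟨ sum-↑ n₁ n₂ (entry (A ⊕ B) b) ⟩
  ∑[ i < n₁ ] entry (A ⊕ B) b (i ↑ˡ n₂) + ∑[ j < n₂ ] entry (A ⊕ B) b (n₁ ↑ʳ j)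
    ≡⟨ cong₂ _+_ (sum-cong-≗ {n₁} (λ i → cong [ entry A b , shiftedB ]′ (splitAt-↑ˡ n₁ i n₂)))
                 (sum-cong-≗ {n₂} (λ j → cong [ entry A b , shiftedB ]′ (splitAt-↑ʳ n₁ n₂ j))) ⟩
  colSum A b + ∑[ j < n₂ ] (top A + entry B b j)
    ≡⟨ cong (colSum A b +_) (∑-distrib-+ (λ _ → top A) (entry B b)) ⟩
  colSum A b + (∑[ _ < n₂ ] top A + colSum B b)
    ≡⟨ cong (λ x → colSum A b + (x + colSum B b)) (sum-const n₂ (top A)) ⟩
  colSum A b + (n₂ * top A + colSum B b) ∎
  where
  open ≡-Reasoning
  shiftedB : Fin n₂ → ℕ
  shiftedB j = top A + entry B b j

⊕-columnMagic : ∀ {q n₁ n₂} (A : LabelArray q n₁) (B : LabelArray q n₂) →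
                IsColumnMagic A → IsColumnMagic B → IsColumnMagic (A ⊕ B)
⊕-columnMagic {n₂ = n₂} A B (s , sA) (s′ , sB) =
  s + (n₂ * top A + s′) ,
  λ b → trans (colSum-⊕ A B b) (cong₂ (λ x y → x + (n₂ * top A + y)) (sA b) (sB b))

rows₂-columnMagic : ∀ {q t₀ t₁} (R₀ : Row q t₀) (R₁ : Row q t₁) c →
  (∀ b → value R₀ b + value R₁ b ≡ c) → IsColumnMagic (row R₀ ⊕ row R₁)
rows₂-columnMagic {t₀ = t₀} R₀ R₁ c sum≡c = c + (t₀ + 2) , λ b → begin
  colSum (row R₀ ⊕ row R₁) b
    ≡⟨ colSum-⊕ (row R₀) (row R₁) b ⟩
  colSum (row R₀) b + (1 * t₀ + colSum (row R₁) b)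
    ≡⟨ cong₂ (λ x y → x + (1 * t₀ + y)) (colSum-row R₀ b) (colSum-row R₁ b) ⟩
  suc (value R₀ b) + (1 * t₀ + suc (value R₁ b))
    ≡⟨ regroup (value R₀ b) (value R₁ b) t₀ ⟩
  (value R₀ b + value R₁ b) + (t₀ + 2)
    ≡⟨ cong (_+ (t₀ + 2)) (sum≡c b) ⟩
  c + (t₀ + 2) ∎
  where
  open ≡-Reasoning
  regroup : ∀ x y t → suc x + (1 * t + suc y) ≡ (x + y) + (t + 2)
  regroup = solve-∀

rows₃-columnMagic : ∀ {q t₀ t₁ t₂} (R₀ : Row q t₀) (R₁ : Row q t₁) (R₂ : Row q t₂) c →
  (∀ b → value R₀ b + value R₁ b + value R₂ b ≡ c) → IsColumnMagic (row R₀ ⊕ row R₁ ⊕ row R₂)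
rows₃-columnMagic {t₀ = t₀} {t₁} R₀ R₁ R₂ c sum≡c = c + (2 * t₀ + t₁ + 3) , λ b → begin
  colSum (row R₀ ⊕ row R₁ ⊕ row R₂) b
    ≡⟨ colSum-⊕ (row R₀) (row R₁ ⊕ row R₂) b ⟩
  colSum (row R₀) b + (2 * t₀ + colSum (row R₁ ⊕ row R₂) b)
    ≡⟨ cong (λ x → colSum (row R₀) b + (2 * t₀ + x)) (colSum-⊕ (row R₁) (row R₂) b) ⟩
  colSum (row R₀) b + (2 * t₀ + (colSum (row R₁) b + (1 * t₁ + colSum (row R₂) b)))
    ≡⟨ cong₂ (λ x y → x + (2 * t₀ + y)) (colSum-row R₀ b)
             (cong₂ (λ x y → x + (1 * t₁ + y)) (colSum-row R₁ b) (colSum-row R₂ b)) ⟩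
  suc (value R₀ b) + (2 * t₀ + (suc (value R₁ b) + (1 * t₁ + suc (value R₂ b))))
    ≡⟨ regroup (value R₀ b) (value R₁ b) (value R₂ b) t₀ t₁ ⟩
  (value R₀ b + value R₁ b + value R₂ b) + (2 * t₀ + t₁ + 3)
    ≡⟨ cong (_+ (2 * t₀ + t₁ + 3)) (sum≡c b) ⟩
  c + (2 * t₀ + t₁ + 3) ∎
  where
  open ≡-Reasoning
  regroup : ∀ x y z t t′ → suc x + (2 * t + (suc y + (1 * t′ + suc z))) ≡ (x + y + z) + (2 * t + t′ + 3)
  regroup = solve-∀

ascending : ∀ q → Row q q
ascending q = record
  { value           = toℕ
  ; value<top       = toℕ<n
  ; value-injective = toℕ-injective
  }

descending : ∀ q → Row q q
descending q = record
  { value           = λ b → q ∸ suc (toℕ b)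
  ; value<top       = λ b → ∸-monoʳ-< z<s (toℕ<n b)
  ; value-injective = λ e → toℕ-injective (suc-injective (∸-cancelˡ-≡ (toℕ<n _) (toℕ<n _) e))
  }

ascending+descending : ∀ q b → value (ascending q) b + value (descending q) b ≡ pred q
ascending+descending q b = cong pred (begin
  suc (toℕ b + (q ∸ suc (toℕ b))) ≡⟨ +-comm (suc (toℕ b)) (q ∸ suc (toℕ b)) ⟩
  (q ∸ suc (toℕ b)) + suc (toℕ b)  ≡⟨ m∸n+n≡m (toℕ<n b) ⟩
  q                                ∎)
  where open ≡-Reasoning

pairArray : ∀ q → LabelArray q 2
pairArray q = row (ascending q) ⊕ row (descending q)

evenArray : ∀ q t → LabelArray q (t * 2)
evenArray q zero    = emptyArray
evenArray q (suc t) = pairArray q ⊕ evenArray q t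

top-evenArray : ∀ q t → top (evenArray q t) ≡ q * (t * 2)
top-evenArray q zero    = sym (*-zeroʳ q)
top-evenArray q (suc t) = trans (cong ((q + q) +_) (top-evenArray q t)) (regroup q (t * 2))
  where
  regroup : ∀ q x → (q + q) + q * x ≡ q * (2 + x)
  regroup = solve-∀

evenArray-columnMagic : ∀ q t → IsColumnMagic (evenArray q t)
evenArray-columnMagic q zero    = 0 , λ _ → refl
evenArray-columnMagic q (suc t) =
  ⊕-columnMagic (pairArray q) (evenArray q t)
    (rows₂-columnMagic (ascending q) (descending q) (pred q) (ascending+descending q))
    (evenArray-columnMagic q t)

double-injective : ∀ {x y} → x + x ≡ y + y → x ≡ y
double-injective {x} {y} e =
  *-cancelˡ-≡ x y 2 (trans (cong (x +_) (+-identityʳ x)) (trans e (sym (cong (y +_) (+-identityʳ y)))))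

-- Three rows with constant column sums on q columns, where q + o = 2k + 1 (o = 0 for odd q and
-- o = 1 for even q).  The columns b with b + k < q form the lower part.  The rows are the rotation
-- b ↦ b + k mod q, the identity pushed up by o on the upper part, and a reflection taking values of
-- one parity on the lower part and of the other parity on the upper part.
module Triple (q k o : ℕ) (o≤1 : o ≤ 1) (q+o≡2k+1 : q + o ≡ suc (k + k)) where

  k≤q : k ≤ q
  k≤q = ≤-trans (m≤m+n k k) (s≤s⁻¹ (begin
    suc (k + k) ≡⟨ sym q+o≡2k+1 ⟩
    q + o       ≤⟨ +-monoʳ-≤ q o≤1 ⟩
    q + 1       ≡⟨ +-comm q 1 ⟩
    suc q       ∎))
    where open ≤-Reasoning

  low⇒≤k : ∀ {x} → x + k < q → x ≤ k
  low⇒≤k {x} low = +-cancelʳ-≤ k x k (s≤s⁻¹ (≤-trans low (≤-trans (m≤m+n q o) (≤-reflexive q+o≡2k+1))))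

  low⇒double< : ∀ {x} → x + k < q → suc (x + x) ≤ q
  low⇒double< {x} low = ≤-trans (s≤s (+-monoʳ-≤ x (low⇒≤k low))) low

  double+o< : ∀ {x} → x < q → suc (x + x + o) ≤ q + q
  double+o< {x} x<q = begin
    suc (x + x + o) ≤⟨ s≤s (+-monoʳ-≤ (x + x) o≤1) ⟩
    suc (x + x + 1) ≡⟨ cong suc (trans (+-assoc x x 1) (cong (x +_) (+-comm x 1))) ⟩
    suc x + suc x   ≤⟨ +-mono-≤ x<q x<q ⟩
    q + q           ∎
    where open ≤-Reasoning

  high⇒q<double+o : ∀ {x} → q ≤ x + k → q < x + x + o
  high⇒q<double+o {x} high = +-cancelˡ-≤ q (suc q) (x + x + o) (begin
    q + suc q             ≡⟨ +-suc q q ⟩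
    suc (q + q)           ≤⟨ s≤s (+-mono-≤ high high) ⟩
    suc ((x + k) + (x + k)) ≡⟨ regroup x k ⟩
    (x + x) + suc (k + k) ≡⟨ cong ((x + x) +_) (sym q+o≡2k+1) ⟩
    (x + x) + (q + o)     ≡⟨ regroup′ x q o ⟩
    q + (x + x + o)       ∎)
    where
    open ≤-Reasoning
    regroup : ∀ x k → suc ((x + k) + (x + k)) ≡ (x + x) + suc (k + k)
    regroup = solve-∀
    regroup′ : ∀ x q o → (x + x) + (q + o) ≡ q + (x + x + o)
    regroup′ = solve-∀

  wrapped<k : ∀ {x} → x < q → q ≤ x + k → x + k ∸ q < k
  wrapped<k {x} x<q high =
    subst (x + k ∸ q <_) (m+n∸m≡n q k) (∸-monoˡ-< (+-monoˡ-< k x<q) high)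

  rotate : Fin q → ℕ
  rotate b with toℕ b + k <? q
  ... | yes _ = toℕ b + k
  ... | no  _ = toℕ b + k ∸ q

  rotate<q : ∀ b → rotate b < q
  rotate<q b with toℕ b + k <? q
  ... | yes low  = low
  ... | no  high = subst (toℕ b + k ∸ q <_) (m+n∸n≡m q q)
                         (∸-monoˡ-< (+-mono-<-≤ (toℕ<n b) k≤q) (≮⇒≥ high))

  rotate-injective : Injective _≡_ _≡_ rotate
  rotate-injective {b} {b′} e with toℕ b + k <? q | toℕ b′ + k <? q
  ... | yes _ | yes _  = toℕ-injective (+-cancelʳ-≡ k _ _ e)
  ... | no  h | no  h′ = toℕ-injective (+-cancelʳ-≡ k _ _ (∸-cancelʳ-≡ (≮⇒≥ h) (≮⇒≥ h′) e))
  ... | yes _ | no  h′ = ⊥-elim (<-irrefl refl (≤-<-trans (≤-trans (m≤n+m k (toℕ b)) (≤-reflexive e))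
                                                         (wrapped<k (toℕ<n b′) (≮⇒≥ h′))))
  ... | no  h | yes _  = ⊥-elim (<-irrefl refl (≤-<-trans (≤-trans (m≤n+m k (toℕ b′)) (≤-reflexive (sym e)))
                                                         (wrapped<k (toℕ<n b) (≮⇒≥ h))))

  low<high : ∀ {x x′} → x + k < q → q ≤ x′ + k → x < x′
  low<high {x} {x′} low high = +-cancelʳ-< k x x′ (<-≤-trans low high)

  shift : Fin q → ℕ
  shift b with toℕ b + k <? q
  ... | yes _ = toℕ b
  ... | no  _ = toℕ b + o

  shift<q+o : ∀ b → shift b < q + o
  shift<q+o b with toℕ b + k <? q
  ... | yes _ = ≤-trans (toℕ<n b) (m≤m+n q o)
  ... | no  _ = +-monoˡ-< o (toℕ<n b)

  shift-injective : Injective _≡_ _≡_ shift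
  shift-injective {b} {b′} e with toℕ b + k <? q | toℕ b′ + k <? q
  ... | yes _   | yes _    = toℕ-injective e
  ... | no  _   | no  _    = toℕ-injective (+-cancelʳ-≡ o _ _ e)
  ... | yes low | no  high = ⊥-elim (<-irrefl e (<-≤-trans (low<high low (≮⇒≥ high)) (m≤m+n _ o)))
  ... | no  high | yes low = ⊥-elim (<-irrefl (sym e) (<-≤-trans (low<high low (≮⇒≥ high)) (m≤m+n _ o)))

  reflect : Fin q → ℕ
  reflect b with toℕ b + k <? q
  ... | yes _ = q ∸ suc (toℕ b + toℕ b)
  ... | no  _ = (q + q) ∸ suc (toℕ b + toℕ b + o)

  reflect<q : ∀ b → reflect b < q
  reflect<q b with toℕ b + k <? q
  ... | yes low  = ∸-monoʳ-< z<s (low⇒double< low)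
  ... | no  high = subst ((q + q) ∸ suc (toℕ b + toℕ b + o) <_) (m+n∸n≡m q q)
                         (∸-monoʳ-< (m≤n⇒m≤1+n (high⇒q<double+o (≮⇒≥ high))) (double+o< (toℕ<n b)))

  -- The two parts of the reflection take values of opposite parity, since q + o is odd.
  parity-clash : ∀ v x x′ → v + suc (x + x) ≡ q → v + suc (x′ + x′ + o) ≡ q + q → ⊥
  parity-clash v x x′ low high = even≢odd (q + x) (k + x′) (begin
    2 * (q + x)                       ≡⟨ double q x ⟩
    (q + q) + (x + x)                 ≡⟨ cong (_+ (x + x)) (sym high) ⟩
    v + suc (x′ + x′ + o) + (x + x)   ≡⟨ regroup v x x′ o ⟩
    v + suc (x + x) + o + (x′ + x′)   ≡⟨ cong (λ y → y + o + (x′ + x′)) low ⟩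
    q + o + (x′ + x′)                 ≡⟨ cong (_+ (x′ + x′)) q+o≡2k+1 ⟩
    suc (k + k + (x′ + x′))           ≡⟨ cong suc (sym (double k x′)) ⟩
    suc (2 * (k + x′))                ∎)
    where
    open ≡-Reasoning
    double : ∀ a b → 2 * (a + b) ≡ (a + a) + (b + b)
    double = solve-∀
    regroup : ∀ v x x′ o → v + suc (x′ + x′ + o) + (x + x) ≡ v + suc (x + x) + o + (x′ + x′)
    regroup = solve-∀

  reflect-injective : Injective _≡_ _≡_ reflect
  reflect-injective {b} {b′} e with toℕ b + k <? q | toℕ b′ + k <? q
  ... | yes low | yes low′ =
    toℕ-injective (double-injective (suc-injective (∸-cancelˡ-≡ (low⇒double< low) (low⇒double< low′) e)))
  ... | no  _   | no  _    =
    toℕ-injective (double-injective (+-cancelʳ-≡ o _ _ (suc-injective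
      (∸-cancelˡ-≡ (double+o< (toℕ<n b)) (double+o< (toℕ<n b′)) e))))
  ... | yes low | no  _    = ⊥-elim (parity-clash _ (toℕ b) (toℕ b′) (m∸n+n≡m (low⇒double< low))
      (trans (cong (_+ suc (toℕ b′ + toℕ b′ + o)) e) (m∸n+n≡m (double+o< (toℕ<n b′)))))
  ... | no  _   | yes low′ = ⊥-elim (parity-clash _ (toℕ b′) (toℕ b) (m∸n+n≡m (low⇒double< low′))
      (trans (cong (_+ suc (toℕ b + toℕ b + o)) (sym e)) (m∸n+n≡m (double+o< (toℕ<n b)))))

  rotate+shift+reflect : ∀ b → suc (rotate b + shift b + reflect b) ≡ k + q
  rotate+shift+reflect b with toℕ b + k <? q
  ... | yes low = begin
    suc (x + k + x + d)  ≡⟨ regroup x k d ⟩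
    k + (d + suc (x + x)) ≡⟨ cong (k +_) (m∸n+n≡m (low⇒double< low)) ⟩
    k + q                ∎
    where
    open ≡-Reasoning
    x = toℕ b
    d = q ∸ suc (x + x)
    regroup : ∀ x k d → suc (x + k + x + d) ≡ k + (d + suc (x + x))
    regroup = solve-∀
  ... | no high = +-cancelʳ-≡ q _ _ (begin
    suc (a + (x + o) + d) + q  ≡⟨ regroup a q x o d ⟩
    (a + q) + suc (x + o + d)  ≡⟨ cong (_+ suc (x + o + d)) (m∸n+n≡m (≮⇒≥ high)) ⟩
    (x + k) + suc (x + o + d)  ≡⟨ regroup′ x k o d ⟩
    k + (d + suc (x + x + o))  ≡⟨ cong (k +_) (m∸n+n≡m (double+o< (toℕ<n b))) ⟩
    k + (q + q)                ≡⟨ sym (+-assoc k q q) ⟩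
    k + q + q                  ∎)
    where
    open ≡-Reasoning
    x = toℕ b
    a = x + k ∸ q
    d = (q + q) ∸ suc (x + x + o)
    regroup : ∀ a q x o d → suc (a + (x + o) + d) + q ≡ (a + q) + suc (x + o + d)
    regroup = solve-∀
    regroup′ : ∀ x k o d → (x + k) + suc (x + o + d) ≡ k + (d + suc (x + x + o))
    regroup′ = solve-∀

  rotation : Row q q
  rotation = record { value = rotate ; value<top = rotate<q ; value-injective = rotate-injective }

  shifted : Row q (q + o)
  shifted = record { value = shift ; value<top = shift<q+o ; value-injective = shift-injective }

  reflection : Row q q
  reflection = record { value = reflect ; value<top = reflect<q ; value-injective = reflect-injective }

  tripleArray : LabelArray q 3
  tripleArray = row rotation ⊕ row shifted ⊕ row reflection

  tripleArray-columnMagic : IsColumnMagic tripleArray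
  tripleArray-columnMagic =
    rows₃-columnMagic rotation shifted reflection (pred (k + q)) (cong pred ∘ rotate+shift+reflect)

oddArray : ∀ q k o t → o ≤ 1 → q + o ≡ suc (k + k) → LabelArray q (3 + t * 2)
oddArray q k o t o≤1 q+o≡2k+1 = Triple.tripleArray q k o o≤1 q+o≡2k+1 ⊕ evenArray q t

top-oddArray : ∀ q k o t o≤1 q+o≡2k+1 → top (oddArray q k o t o≤1 q+o≡2k+1) ≡ q * (3 + t * 2) + o
top-oddArray q k o t _ _ = trans (cong (q + (q + o + q) +_) (top-evenArray q t)) (regroup q o (t * 2))
  where
  regroup : ∀ q o x → q + (q + o + q) + q * x ≡ q * (3 + x) + o
  regroup = solve-∀

oddArray-columnMagic : ∀ q k o t o≤1 q+o≡2k+1 → IsColumnMagic (oddArray q k o t o≤1 q+o≡2k+1)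
oddArray-columnMagic q k o t o≤1 q+o≡2k+1 =
  ⊕-columnMagic (Triple.tripleArray q k o o≤1 q+o≡2k+1) (evenArray q t)
    (Triple.tripleArray-columnMagic q k o o≤1 q+o≡2k+1) (evenArray-columnMagic q t)

-- Column combine i j of the array labels part j of copy i; its rows label the positions in that part.
module _ (m n p : ℕ) (A : LabelArray (m * p) n) where

  arrayLabel : Fin (m * (p * n)) → ℕ
  arrayLabel v = entry A (combine (copyOf m p n v) (partOf m p n v)) (positionOf m n p v)

  arrayLabel-vertex : ∀ i j r → arrayLabel (vertex m n p i j r) ≡ entry A (combine i j) r
  arrayLabel-vertex i j r =
    cong₂ (entry A) (cong₂ combine (copyOf-vertex m n p i j r) (partOf-vertex m n p i j r))
                    (positionOf-vertex m n p i j r)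

  arrayLabel-injective : Injective _≡_ _≡_ arrayLabel
  arrayLabel-injective {v} {w} e with entry-injective A e
  ... | same-column , same-position
    with combine-injective (copyOf m p n v) (partOf m p n v) (copyOf m p n w) (partOf m p n w) same-column
  ... | same-copy , same-part = begin
    v                                                           ≡⟨ sym (vertex-decomposition m n p v) ⟩
    vertex m n p (copyOf m p n v) (partOf m p n v) (positionOf m n p v)
      ≡⟨ cong₂ (λ i j → vertex m n p i j (positionOf m n p v)) same-copy same-part ⟩
    vertex m n p (copyOf m p n w) (partOf m p n w) (positionOf m n p v)
      ≡⟨ cong (vertex m n p (copyOf m p n w) (partOf m p n w)) same-position ⟩
    vertex m n p (copyOf m p n w) (partOf m p n w) (positionOf m n p w) ≡⟨ vertex-decomposition m n p w ⟩
    w                                                           ∎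
    where open ≡-Reasoning

  maxLabel-arrayLabel : maxLabel arrayLabel ≤ top A
  maxLabel-arrayLabel = maxLabel≤ arrayLabel (λ v → entry≤top A _ _)

  arrayLabel-magic : IsColumnMagic A → IsMagicLabelling (mH m n p) arrayLabel
  arrayLabel-magic (s , colSum≡s) =
    arrayLabel-injective , (λ v → entry-positive A _ _) , p * s ∸ s , λ u → begin
      nbrSum (mH m n p) arrayLabel u
        ≡⟨ sym (m+n∸n≡m _ s) ⟩
      nbrSum (mH m n p) arrayLabel u + s ∸ s
        ≡⟨ cong (λ x → nbrSum (mH m n p) arrayLabel u + x ∸ s) (sym (partSum≡s _ _)) ⟩
      nbrSum (mH m n p) arrayLabel u + partSum m n p arrayLabel (copyOf m p n u) (partOf m p n u) ∸ s
        ≡⟨ cong (_∸ s) (nbrSum+partSum m n p arrayLabel u) ⟩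
      ∑[ j < p ] partSum m n p arrayLabel (copyOf m p n u) j ∸ s
        ≡⟨ cong (_∸ s) (trans (sum-cong-≗ {p} (partSum≡s _)) (sum-const p s)) ⟩
      p * s ∸ s ∎
    where
    open ≡-Reasoning
    partSum≡s : ∀ i j → partSum m n p arrayLabel i j ≡ s
    partSum≡s i j = trans (sum-cong-≗ {n} (arrayLabel-vertex i j)) (colSum≡s (combine i j))

-- The distance magic index

magicIndexIs : ∀ G k f → IsMagicLabelling G f → maxLabel f ≤ k →
               (∀ g → IsMagicLabelling G g → k ≤ maxLabel g) → MagicIndexIs G k
magicIndexIs G k f f-magic f≤k lower = (f , f-magic , ≤-antisym f≤k (lower f f-magic)) , lower

distMagicIndex-array : ∀ m n p θ (A : LabelArray (m * p) n) → IsColumnMagic A → top A ≡ (m * p) * n + θ →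
  (∀ g → IsMagicLabelling (mH m n p) g → m * (p * n) + θ ≤ maxLabel g) → DistMagicIndexIs (mH m n p) θ
distMagicIndex-array m n p θ A A-magic top≡ lower =
  magicIndexIs (mH m n p) (m * (p * n) + θ) (arrayLabel m n p A) (arrayLabel-magic m n p A A-magic)
    (subst (maxLabel (arrayLabel m n p A) ≤_) (trans top≡ (cong (_+ θ) (*-assoc m p n)))
      (maxLabel-arrayLabel m n p A))
    lower

mH-order≤maxLabel : ∀ m n p g → IsMagicLabelling (mH m n p) g → m * (p * n) + 0 ≤ maxLabel g
mH-order≤maxLabel m n p g (g-inj , g-pos , _) =
  subst (_≤ maxLabel g) (sym (+-identityʳ _)) (size≤maxLabel g g-inj g-pos)

mH-order<maxLabel : ∀ m t p k → suc m * suc (suc p) ≡ k * 2 → ∀ g →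
  IsMagicLabelling (mH (suc m) (suc (t * 2)) (suc (suc p))) g →
  suc m * (suc (suc p) * suc (t * 2)) < maxLabel g
mH-order<maxLabel m t p k q≡k*2 g (g-inj , g-pos , c , magic)
  with maxLabel g ≤? suc m * (suc (suc p) * suc (t * 2))
... | no  g≰N = ≰⇒> g≰N
... | yes g≤N = ⊥-elim (even≢odd β (t + k * n + 2 * t * (k * n)) 2β≡odd)
  where
  M = suc m
  P = suc (suc p)
  n = suc (t * 2)
  N = M * (P * n)
  β = proj₁ (magic⇒partSums-equal m (t * 2) p g c magic)
  sum≡ : sum g ≡ M * (P * β)
  sum≡ = sum-equalPartSums M n P g β (proj₂ (magic⇒partSums-equal m (t * 2) p g c magic))
  2β≡odd : 2 * β ≡ suc (2 * (t + k * n + 2 * t * (k * n)))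
  2β≡odd = begin
    2 * β                     ≡⟨ *-cancelˡ-≡ (2 * β) (n * suc N) (M * P) (begin
      (M * P) * (2 * β)          ≡⟨ regroup M P β ⟩
      2 * (M * (P * β))          ≡⟨ cong (2 *_) (sym sum≡) ⟩
      2 * sum g                  ≡⟨ 2*sum≡triangular N g g-inj g-pos (λ v → ≤-trans (label≤maxLabel g v) g≤N) ⟩
      N * suc N                  ≡⟨ cong (_* suc N) (sym (*-assoc M P n)) ⟩
      (M * P) * n * suc N        ≡⟨ *-assoc (M * P) n (suc N) ⟩
      (M * P) * (n * suc N)      ∎) ⟩
    n * suc N                 ≡⟨ cong (λ x → n * suc x) (trans (sym (*-assoc M P n)) (cong (_* n) q≡k*2)) ⟩
    n * suc (k * 2 * n)       ≡⟨ odd*odd t k n ⟩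
    suc (2 * (t + k * n + 2 * t * (k * n))) ∎
    where
    open ≡-Reasoning
    regroup : ∀ M P β → (M * P) * (2 * β) ≡ 2 * (M * (P * β))
    regroup = solve-∀
    odd*odd : ∀ t k n → suc (t * 2) * suc (k * 2 * n) ≡ suc (2 * (t + k * n + 2 * t * (k * n)))
    odd*odd = solve-∀

k*2≡k+k : ∀ k → k * 2 ≡ k + k
k*2≡k+k = solve-∀

mH-θ≡0-evenPartSize : ∀ m p t → DistMagicIndexIs (mH m (t * 2) p) 0
mH-θ≡0-evenPartSize m p t =
  distMagicIndex-array m (t * 2) p 0 (evenArray (m * p) t) (evenArray-columnMagic (m * p) t)
    (trans (top-evenArray (m * p) t) (sym (+-identityʳ _))) (mH-order≤maxLabel m (t * 2) p)

mH-θ≡0-oddOrder : ∀ m p t k → m * p ≡ suc (k * 2) → DistMagicIndexIs (mH m (3 + t * 2) p) 0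
mH-θ≡0-oddOrder m p t k q≡2k+1 =
  distMagicIndex-array m (3 + t * 2) p 0 (oddArray q k 0 t z≤n q+0≡2k+1)
    (oddArray-columnMagic q k 0 t z≤n q+0≡2k+1) (top-oddArray q k 0 t z≤n q+0≡2k+1)
    (mH-order≤maxLabel m (3 + t * 2) p)
  where
  q = m * p
  q+0≡2k+1 : q + 0 ≡ suc (k + k)
  q+0≡2k+1 = trans (+-identityʳ q) (trans q≡2k+1 (cong suc (k*2≡k+k k)))

mH-θ≡1 : ∀ m p t k → suc m * suc (suc p) ≡ k * 2 →
         DistMagicIndexIs (mH (suc m) (3 + t * 2) (suc (suc p))) 1
mH-θ≡1 m p t k q≡2k =
  distMagicIndex-array (suc m) (3 + t * 2) (suc (suc p)) 1 (oddArray q k 1 t ≤-refl q+1≡2k+1)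
    (oddArray-columnMagic q k 1 t ≤-refl q+1≡2k+1) (top-oddArray q k 1 t ≤-refl q+1≡2k+1)
    (λ g g-magic → subst (_≤ maxLabel g) (+-comm 1 _) (mH-order<maxLabel m (suc t) p k q≡2k g g-magic))
  where
  q = suc m * suc (suc p)
  q+1≡2k+1 : q + 1 ≡ suc (k + k)
  q+1≡2k+1 = trans (+-comm q 1) (cong suc (trans q≡2k (k*2≡k+k k)))

even-or-odd : ∀ x → (x % 2 ≡ 0 × ∃ λ k → x ≡ k * 2) ⊎ (x % 2 ≡ 1 × ∃ λ k → x ≡ suc (k * 2))
even-or-odd x with x % 2 | m%n<n x 2 | m≡m%n+[m/n]*n x 2
... | 0           | _            | x≡ = inj₁ (refl , x / 2 , x≡)
... | 1           | _            | x≡ = inj₂ (refl , x / 2 , x≡)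
... | suc (suc _) | s≤s (s≤s ()) | _

%2-oddFactor : ∀ m n p → n % 2 ≡ 1 → (m * n * p) % 2 ≡ (m * p) % 2
%2-oddFactor m n p n%2≡1 = begin
  (m * n * p) % 2               ≡⟨ cong (_% 2) (regroup m n p) ⟩
  (m * p * n) % 2               ≡⟨ %-distribˡ-* (m * p) n 2 ⟩
  ((m * p) % 2 * (n % 2)) % 2   ≡⟨ cong (λ r → ((m * p) % 2 * r) % 2) n%2≡1 ⟩
  ((m * p) % 2 * 1) % 2         ≡⟨ cong (_% 2) (*-identityʳ ((m * p) % 2)) ⟩
  ((m * p) % 2) % 2             ≡⟨ m%n%n≡m%n (m * p) 2 ⟩
  (m * p) % 2                   ∎
  where
  open ≡-Reasoning
  regroup : ∀ m n p → m * n * p ≡ m * p * n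
  regroup = solve-∀

theorem13 : (n p m : ℕ) → 1 < n → 1 < p → 1 ≤ m →
    ((n % 2 ≡ 0 ⊎ (m * n * p) % 2 ≡ 1) → DistMagicIndexIs (mH m n p) 0) ×
    (¬ (n % 2 ≡ 0 ⊎ (m * n * p) % 2 ≡ 1) → DistMagicIndexIs (mH m n p) 1)
theorem13 n (suc (suc p)) (suc m) 1<n (s≤s (s≤s _)) (s≤s _) with even-or-odd n
... | inj₁ (n%2≡0 , t , refl) =
  (λ _ → mH-θ≡0-evenPartSize (suc m) (suc (suc p)) t) , (λ ¬c → ⊥-elim (¬c (inj₁ n%2≡0)))
... | inj₂ (_ , zero , refl) = ⊥-elim (<-irrefl refl 1<n)
... | inj₂ (n%2≡1 , suc t , refl) with even-or-odd (suc m * suc (suc p))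
...   | inj₂ (q%2≡1 , k , q≡2k+1) =
  (λ _ → mH-θ≡0-oddOrder (suc m) (suc (suc p)) t k q≡2k+1) ,
  (λ ¬c → ⊥-elim (¬c (inj₂ (trans (%2-oddFactor (suc m) (3 + t * 2) (suc (suc p)) n%2≡1) q%2≡1))))
...   | inj₁ (q%2≡0 , k , q≡2k) =
  (λ { (inj₁ n%2≡0) → ⊥-elim (0≢1+n (trans (sym n%2≡0) n%2≡1))
     ; (inj₂ mnp%2≡1) → ⊥-elim (0≢1+n (trans (sym q%2≡0)
                          (trans (sym (%2-oddFactor (suc m) (3 + t * 2) (suc (suc p)) n%2≡1)) mnp%2≡1))) }) ,
  (λ _ → mH-θ≡1 m p t k q≡2k)
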